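{- Let $\Gamma$ be a connected vertex-transitive graph whose local graph is isomorphic to the disjoint union $K_3\cup K_2$. Then $\Gamma$ admits a strong clique if and only if $\Gamma\cong K_3\square K_4$.
   Context: All graphs are finite and simple. The local graph of $\Gamma$ at $v$ is the subgraph induced by the neighbours of $v$. A clique is strong if it intersects every inclusion-maximal independent set. $K_3\square K_4$ is the Cartesian product: vertex set $V(K_3)\times V(K_4)$, $(x_1,y_1)\sim(x_2,y_2)$ iff exactly one coordinate differs. A graph is vertex-transitive if its automorphism group acts transitively on its vertices. -}

module Defs where

open import Data.Bool using (Bool; true; false; not; _∧_; _∨_; _xor_)
open import Data.Nat using (ℕ; _+_; _*_)
open import Data.Fin using (Fin; splitAt; remQuot; _≟_)
open import Data.Fin.Subset using (Subset; _∈_; _⊆_)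
open import Data.Product using (Σ; ∃; _×_; _,_; proj₁; proj₂)
open import Data.Sum using (_⊎_; inj₁; inj₂)
open import Function.Bundles using (_↔_; Inverse)
open import Relation.Nullary.Decidable using (⌊_⌋; yes; no)
open import Data.Empty using (⊥-elim)
open import Relation.Nullary using (¬_)
open import Relation.Binary.PropositionalEquality using (_≡_; refl; sym)

record Graph : Set where
  field
    n      : ℕ
    adj    : Fin n → Fin n → Bool
    adj-sym    : ∀ u v → adj u v ≡ adj v u
    adj-irrefl : ∀ v → adj v v ≡ false

open Graph public

Vtx : Graph → Set
Vtx G = Fin (n G)

Adj : (G : Graph) → Vtx G → Vtx G → Set
Adj G u v = adj G u v ≡ true

record _≅_ (G H : Graph) : Set where
  field
    bij      : Vtx G ↔ Vtx H
    preserve : ∀ u v → adj G u v ≡ adj H (Inverse.to bij u) (Inverse.to bij v)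

-- Local graph of G at v: the subgraph induced by the neighbours of v.
-- "The local graph at v is isomorphic to H": a bijection between the
-- vertices of H and the neighbours of v, preserving/reflecting adjacency
-- (adjacency in the induced subgraph is adjacency in G).
Neighbour : (G : Graph) → Vtx G → Set
Neighbour G v = Σ (Vtx G) (λ u → Adj G v u)

record LocalGraphIso (G : Graph) (v : Vtx G) (H : Graph) : Set where
  field
    bij      : Vtx H ↔ Neighbour G v
    preserve : ∀ a b → adj H a b ≡ adj G (proj₁ (Inverse.to bij a)) (proj₁ (Inverse.to bij b))

data Reachable (G : Graph) : Vtx G → Vtx G → Set where
  here : ∀ {v} → Reachable G v v
  step : ∀ {u w v} → Adj G u w → Reachable G w v → Reachable G u v

Connected : Graph → Set
Connected G = ∀ u v → Reachable G u v

VertexTransitive : Graph → Set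
VertexTransitive G =
  ∀ u v → Σ (G ≅ G) (λ φ → Inverse.to (_≅_.bij φ) u ≡ v)

IsClique : (G : Graph) → Subset (n G) → Set
IsClique G C = ∀ u v → u ∈ C → v ∈ C → ¬ (u ≡ v) → Adj G u v
   

IsIndependent : (G : Graph) → Subset (n G) → Set
IsIndependent G S = ∀ u v → u ∈ S → v ∈ S → adj G u v ≡ false

IsMaximalIndependent : (G : Graph) → Subset (n G) → Set
IsMaximalIndependent G S =
  IsIndependent G S × (∀ T → IsIndependent G T → S ⊆ T → T ⊆ S)

IsStrongClique : (G : Graph) → Subset (n G) → Set
IsStrongClique G C =
  IsClique G C × (∀ S → IsMaximalIndependent G S → ∃ λ v → v ∈ C × v ∈ S)

HasStrongClique : Graph → Set
HasStrongClique G = ∃ λ C → IsStrongClique G C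

neqᵇ : ∀ {k} → Fin k → Fin k → Bool
neqᵇ x y = not ⌊ x ≟ y ⌋

neqᵇ-sym : ∀ {k} (x y : Fin k) → neqᵇ x y ≡ neqᵇ y x
neqᵇ-sym x y with x ≟ y | y ≟ x
... | yes _ | yes _ = refl
... | no _  | no _  = refl
... | yes p | no q  = ⊥-elim (q (sym p))
... | no p  | yes q = ⊥-elim (p (sym q))

neqᵇ-irrefl : ∀ {k} (x : Fin k) → neqᵇ x x ≡ false
neqᵇ-irrefl x with x ≟ x
... | yes _ = refl
... | no p  = ⊥-elim (p refl)

K : ℕ → Graph
K k = record { n = k ; adj = neqᵇ ; adj-sym = neqᵇ-sym ; adj-irrefl = neqᵇ-irrefl }

duAdj : (G H : Graph) → Fin (n G + n H) → Fin (n G + n H) → Bool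
duAdj G H x y with splitAt (n G) x | splitAt (n G) y
... | inj₁ a | inj₁ b = adj G a b
... | inj₂ a | inj₂ b = adj H a b
... | inj₁ _ | inj₂ _ = false
... | inj₂ _ | inj₁ _ = false

duSym : (G H : Graph) → ∀ x y → duAdj G H x y ≡ duAdj G H y x
duSym G H x y with splitAt (n G) x | splitAt (n G) y
... | inj₁ a | inj₁ b = adj-sym G a b
... | inj₂ a | inj₂ b = adj-sym H a b
... | inj₁ _ | inj₂ _ = refl
... | inj₂ _ | inj₁ _ = refl

duIrr : (G H : Graph) → ∀ x → duAdj G H x x ≡ false
duIrr G H x with splitAt (n G) x
... | inj₁ a = adj-irrefl G a
... | inj₂ a = adj-irrefl H a

_⊕_ : Graph → Graph → Graph
G ⊕ H = record { n = n G + n H ; adj = duAdj G H ; adj-sym = duSym G H ; adj-irrefl = duIrr G H }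

-- Cartesian product K_p □ K_q on Fin (p * q) (via remQuot, i.e. pairs
-- (x , y)): adjacent iff exactly one coordinate differs.
pairAdj : ∀ {p q} → Fin p × Fin q → Fin p × Fin q → Bool
pairAdj (x₁ , y₁) (x₂ , y₂) = neqᵇ x₁ x₂ xor neqᵇ y₁ y₂

kkAdj : ∀ p q → Fin (p * q) → Fin (p * q) → Bool
kkAdj p q u v = pairAdj (remQuot {p} q u) (remQuot {p} q v)

pairSym : ∀ {p q} (a b : Fin p × Fin q) → pairAdj a b ≡ pairAdj b a
pairSym (x₁ , y₁) (x₂ , y₂) rewrite neqᵇ-sym x₁ x₂ | neqᵇ-sym y₁ y₂ = refl

pairIrr : ∀ {p q} (a : Fin p × Fin q) → pairAdj a a ≡ false
pairIrr (x , y) rewrite neqᵇ-irrefl x | neqᵇ-irrefl y = refl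

kkSym : ∀ p q u v → kkAdj p q u v ≡ kkAdj p q v u
kkSym p q u v = pairSym (remQuot {p} q u) (remQuot {p} q v)

kkIrr : ∀ p q u → kkAdj p q u u ≡ false
kkIrr p q u = pairIrr (remQuot {p} q u)

K□K : ℕ → ℕ → Graph
K□K p q = record { n = p * q ; adj = kkAdj p q ; adj-sym = kkSym p q ; adj-irrefl = kkIrr p q }

-- Every vertex v lies in exactly one red clique R(v) ≅ K₄ and one blue clique ≅ K₃, the two components of its
-- local graph. A strong clique C through v lies in R(v), since a blue clique is dominated by an independent
-- triple. Choosing one blue neighbour for each of the four vertices of R(v) therefore never gives an independent
-- set (it would dominate C): two choices always share a red clique. A finite analysis of the partitions of these
-- eight blue neighbours shows that either some red clique receives a blue edge from all of R(v), or both blue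
-- neighbours of some vertex of R(v) have red cliques receiving blue edges from at least three vertices of R(v).
-- Vertex-transitivity spreads this to every vertex, and either way each vertex c ends up with the red cliques of
-- its two blue neighbours joined to all of R(c) by blue edges. These three red cliques form a copy of K₃ □ K₄
-- closed under taking neighbours, hence all of Γ. Conversely, a maximal independent set of K₃ □ K₄ missing a row
-- of four vertices meets every column in one of the two other rows, hence some row twice.

module Submission where

open import Axiom.UniquenessOfIdentityProofs using (module Decidable⇒UIP)
open import Data.Bool using (Bool; true; false; _∧_)
open import Data.Bool.Properties using (¬-not; T-≡) renaming (_≟_ to _≟ᵇ_)
open import Data.Empty using (⊥; ⊥-elim)
open import Data.Fin using (Fin; zero; suc; toℕ; _≟_; _<_; _<?_; punchIn; punchOut; _↑ˡ_; _↑ʳ_; splitAt; join; remQuot; combine)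
open import Data.Fin.Properties
  using (any?; all?; ¬∀⟶∃¬; pigeonhole; <⇒notInjective; <⇒≢; <-cmp; 0≢1+n; toℕ-injective; ↑ˡ-injective; ↑ʳ-injective;
         splitAt-↑ˡ; splitAt-↑ʳ; join-splitAt; punchInᵢ≢i; punchIn-injective; punchOut-injective;
         remQuot-combine; combine-remQuot)
open import Data.Fin.Subset using (Subset; _∈_; _⊆_; _∪_; ⁅_⁆) renaming (⊥ to ∅)
open import Data.Fin.Subset.Properties using (_∈?_; ∉⊥; x∈⁅x⁆; x∈⁅y⁆⇒x≡y; p⊆p∪q; q⊆p∪q; x∈p∪q⁻)
open import Data.List using (List; []; _∷_; allFin)
open import Data.List.Membership.Propositional using () renaming (_∈_ to _∈ₗ_)
open import Data.List.Membership.Propositional.Properties using (∈-allFin)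
open import Data.List.Relation.Unary.Any using (here; there)
import Data.Nat as ℕ
open import Data.Nat using (ℕ; _≤_; z≤n; s≤s; s≤s⁻¹; _*_) renaming (_<_ to _<ℕ_)
open import Data.Nat.Properties using (n<1+n; ≤-antisym; n≤0⇒n≡0; ≤∧≢⇒<)
open import Data.Product using (∃; ∃₂; _×_; _,_; proj₁; proj₂; uncurry)
open import Data.Product.Properties using (×-≡,≡→≡)
open import Data.Sum using (_⊎_; inj₁; inj₂)
open import Data.Vec using ([]; _∷_; lookup; tabulate)
open import Data.Vec.Properties using (lookup∘tabulate; []=⇒lookup; lookup⇒[]=)
open import Function using (id; _∘_)
open import Function.Bundles using (_⇔_; mk⇔; Equivalence; Inverse; mk↔ₛ′)
open import Level using (0ℓ)
open import Relation.Binary using (Rel; tri<; tri≈; tri>)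
open import Relation.Binary.PropositionalEquality
open import Relation.Nullary using (¬_; Dec; yes; no; does)
open import Relation.Nullary.Decidable using (_×-dec_; _⊎-dec_; _→-dec_; ¬?; dec-true; decidable-stable; toWitness; isYes)
open import Relation.Unary using (Pred; Decidable)

open import Defs

setOf : ∀ {n p} {P : Pred (Fin n) p} → Decidable P → Subset n
setOf P? = tabulate (does ∘ P?)

module _ {n p} {P : Pred (Fin n) p} (P? : Decidable P) where

  ∈-setOf⁺ : ∀ {x} → P x → x ∈ setOf P?
  ∈-setOf⁺ {x} px = lookup⇒[]= x _ (trans (lookup∘tabulate (does ∘ P?) x) (dec-true (P? x) px))

  ∈-setOf⁻ : ∀ {x} → x ∈ setOf P? → P x
  ∈-setOf⁻ {x} x∈ with P? x | trans (sym (lookup∘tabulate (does ∘ P?) x)) ([]=⇒lookup x∈)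
  ... | yes px | _ = px
  ... | no _   | ()

image : ∀ {k n} → (Fin k → Fin n) → Subset n
image h = setOf λ u → any? λ i → h i ≟ u

∈-image⁺ : ∀ {k n} (h : Fin k → Fin n) i → h i ∈ image h
∈-image⁺ h i = ∈-setOf⁺ (λ u → any? λ i → h i ≟ u) (i , refl)

∈-image⁻ : ∀ {k n} (h : Fin k → Fin n) {u} → u ∈ image h → ∃ λ i → h i ≡ u
∈-image⁻ h = ∈-setOf⁻ (λ u → any? λ i → h i ≟ u)

injective⇒surjective : ∀ {m} (f : Fin m → Fin m) → (∀ {i j} → f i ≡ f j → i ≡ j) → ∀ y → ∃ λ i → f i ≡ y
injective⇒surjective {ℕ.suc m} f f-injective y with any? (λ i → f i ≟ y)
... | yes hit  = hit
... | no  miss = ⊥-elim (<⇒notInjective (n<1+n m) g-injective)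
  where
  g : Fin (ℕ.suc m) → Fin m
  g i = punchOut {i = y} {j = f i} λ y≡fi → miss (i , sym y≡fi)
  g-injective : ∀ {i j} → g i ≡ g j → i ≡ j
  g-injective {i} {j} eq = f-injective (punchOut-injective {i = y} (λ e → miss (i , sym e)) (λ e → miss (j , sym e)) eq)

injective-avoids : ∀ {k m} (f : Fin (ℕ.suc k) → Fin m) → (∀ {i j} → f i ≡ f j → i ≡ j) →
                   (d : Fin k → Fin m) → ∃ λ i → ∀ l → f i ≢ d l
injective-avoids {k} f f-injective d with any? (λ i → all? λ l → ¬? (f i ≟ d l))
... | yes found = found
... | no  none  = ⊥-elim (<⇒notInjective (n<1+n k) hit-injective)
  where
  hit : ∀ i → ∃ λ l → f i ≡ d l
  hit i with l , ¬f≢d ← ¬∀⟶∃¬ k _ (λ l → ¬? (f i ≟ d l)) (λ f≢d → none (i , f≢d)) =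
    l , decidable-stable (f i ≟ d l) ¬f≢d
  hit-injective : ∀ {i j} → proj₁ (hit i) ≡ proj₁ (hit j) → i ≡ j
  hit-injective {i} {j} eq = f-injective (trans (proj₂ (hit i)) (trans (cong d eq) (sym (proj₂ (hit j)))))

least-witness : ∀ {m} {P : Pred (Fin m) 0ℓ} → Decidable P → ∀ {k} → P k → ∃ λ j → P j × ∀ {j′} → P j′ → toℕ j ≤ toℕ j′
least-witness {ℕ.suc m} {P} P? {k} pk with P? zero
... | yes p₀ = zero , p₀ , λ _ → z≤n
... | no ¬p₀ with k
... | zero  = ⊥-elim (¬p₀ pk)
... | suc k′ with j , pj , minimal ← least-witness (P? ∘ suc) {k′} pk = suc j , pj , minimal′
  where
  minimal′ : ∀ {j′} → P j′ → toℕ (suc j) ≤ toℕ j′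
  minimal′ {zero}   p = ⊥-elim (¬p₀ p)
  minimal′ {suc j′} p = s≤s (minimal p)

module ReflexiveClosure {m} (R : Rel (Fin m) 0ℓ) (R-sym : ∀ {u w} → R u w → R w u)
                        (R-trans : ∀ {u v w} → R u v → R v w → u ≢ w → R u w)
                        (R? : ∀ u w → Dec (R u w)) where

  Closure : Rel (Fin m) 0ℓ
  Closure u w = u ≡ w ⊎ R u w

  closure-sym : ∀ {u w} → Closure u w → Closure w u
  closure-sym (inj₁ refl) = inj₁ refl
  closure-sym (inj₂ r)    = inj₂ (R-sym r)

  closure-trans : ∀ {u v w} → Closure u v → Closure v w → Closure u w
  closure-trans (inj₁ refl) c           = c
  closure-trans (inj₂ r)    (inj₁ refl) = inj₂ r
  closure-trans {u} {_} {w} (inj₂ r) (inj₂ r′) with u ≟ w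
  ... | yes u≡w = inj₁ u≡w
  ... | no  u≢w = inj₂ (R-trans r r′ u≢w)

  closure? : ∀ u w → Dec (Closure u w)
  closure? u w = (u ≟ w) ⊎-dec R? u w

-- Graphs, maximal independent sets and isomorphisms

module GraphProperties (G : Graph) where

  Adj-sym : ∀ {u v} → Adj G u v → Adj G v u
  Adj-sym {u} {v} a = trans (adj-sym G v u) a

  Adj⇒≢ : ∀ {u v} → Adj G u v → u ≢ v
  Adj⇒≢ {u} a refl with () ← trans (sym a) (adj-irrefl G u)

  ¬Adj⇒adj≡false : ∀ {u v} → ¬ Adj G u v → adj G u v ≡ false
  ¬Adj⇒adj≡false = ¬-not

  Adj? : ∀ u v → Dec (Adj G u v)
  Adj? u v = adj G u v ≟ᵇ true

neqᵇ-≢ : ∀ {k} {x y : Fin k} → x ≢ y → neqᵇ x y ≡ true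
neqᵇ-≢ {x = x} {y} x≢y with x ≟ y
... | yes x≡y = ⊥-elim (x≢y x≡y)
... | no _    = refl

module _ (G H : Graph) where

  ⊕-adj-ˡˡ : ∀ a b → adj (G ⊕ H) (a ↑ˡ n H) (b ↑ˡ n H) ≡ adj G a b
  ⊕-adj-ˡˡ a b rewrite splitAt-↑ˡ (n G) a (n H) | splitAt-↑ˡ (n G) b (n H) = refl

  ⊕-adj-ʳʳ : ∀ a b → adj (G ⊕ H) (n G ↑ʳ a) (n G ↑ʳ b) ≡ adj H a b
  ⊕-adj-ʳʳ a b rewrite splitAt-↑ʳ (n G) (n H) a | splitAt-↑ʳ (n G) (n H) b = refl

  ⊕-adj-ˡʳ : ∀ a b → adj (G ⊕ H) (a ↑ˡ n H) (n G ↑ʳ b) ≡ false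
  ⊕-adj-ˡʳ a b rewrite splitAt-↑ˡ (n G) a (n H) | splitAt-↑ʳ (n G) (n H) b = refl

module Independence (G : Graph) where
  open GraphProperties G

  Blocked : Subset (n G) → Vtx G → Set
  Blocked S w = ∃ λ u → u ∈ S × Adj G u w

  blocked? : ∀ S w → Dec (Blocked S w)
  blocked? S w = any? λ u → (u ∈? S) ×-dec Adj? u w

  greedy : Subset (n G) → List (Vtx G) → Subset (n G)
  greedy S []       = S
  greedy S (w ∷ ws) with blocked? S w
  ... | yes _ = greedy S ws
  ... | no  _ = greedy (S ∪ ⁅ w ⁆) ws

  greedy-⊇ : ∀ S ws → S ⊆ greedy S ws
  greedy-⊇ S []       x∈ = x∈
  greedy-⊇ S (w ∷ ws) x∈ with blocked? S w
  ... | yes _ = greedy-⊇ S ws x∈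
  ... | no  _ = greedy-⊇ (S ∪ ⁅ w ⁆) ws (p⊆p∪q ⁅ w ⁆ x∈)

  insert-independent : ∀ {S w} → IsIndependent G S → ¬ Blocked S w → IsIndependent G (S ∪ ⁅ w ⁆)
  insert-independent {S} {w} indS free u v u∈ v∈ with x∈p∪q⁻ S ⁅ w ⁆ u∈ | x∈p∪q⁻ S ⁅ w ⁆ v∈
  ... | inj₁ u∈S | inj₁ v∈S = indS u v u∈S v∈S
  ... | inj₁ u∈S | inj₂ v∈w rewrite x∈⁅y⁆⇒x≡y w v∈w = ¬Adj⇒adj≡false λ a → free (u , u∈S , a)
  ... | inj₂ u∈w | inj₁ v∈S rewrite x∈⁅y⁆⇒x≡y w u∈w =
    ¬Adj⇒adj≡false λ a → free (v , v∈S , Adj-sym a)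
  ... | inj₂ u∈w | inj₂ v∈w rewrite x∈⁅y⁆⇒x≡y w u∈w | x∈⁅y⁆⇒x≡y w v∈w = adj-irrefl G w

  greedy-independent : ∀ {S} ws → IsIndependent G S → IsIndependent G (greedy S ws)
  greedy-independent         []       indS = indS
  greedy-independent {S} (w ∷ ws) indS with blocked? S w
  ... | yes _    = greedy-independent ws indS
  ... | no  free = greedy-independent ws (insert-independent indS free)

  greedy-blocks : ∀ S {w} ws → w ∈ₗ ws → w ∈ greedy S ws ⊎ Blocked (greedy S ws) w
  greedy-blocks S (w ∷ ws) w∈ with blocked? S w
  greedy-blocks S (w ∷ ws) (here refl) | yes (u , u∈ , a) = inj₂ (u , greedy-⊇ S ws u∈ , a)
  greedy-blocks S (w ∷ ws) (there w∈)  | yes _ = greedy-blocks S ws w∈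
  greedy-blocks S (w ∷ ws) (here refl) | no  _ = inj₁ (greedy-⊇ (S ∪ ⁅ w ⁆) ws (q⊆p∪q S ⁅ w ⁆ (x∈⁅x⁆ w)))
  greedy-blocks S (w ∷ ws) (there w∈)  | no  _ = greedy-blocks (S ∪ ⁅ w ⁆) ws w∈

  maximal-extension : ∀ {S} → IsIndependent G S → ∃ λ T → IsMaximalIndependent G T × S ⊆ T
  maximal-extension {S} indS = T , (greedy-independent vs indS , maximal) , greedy-⊇ S vs
    where
    vs = allFin (n G)
    T = greedy S vs
    maximal : ∀ T′ → IsIndependent G T′ → T ⊆ T′ → T′ ⊆ T
    maximal T′ indT′ T⊆T′ {x} x∈T′ with greedy-blocks S vs (∈-allFin x)
    ... | inj₁ x∈T = x∈T
    ... | inj₂ (u , u∈T , a) with () ← trans (sym a) (indT′ u x (T⊆T′ u∈T) x∈T′)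

  strong-nonempty : ∀ {C} → IsStrongClique G C → ∃ λ v → v ∈ C
  strong-nonempty (_ , meets) with T , maxT , _ ← maximal-extension {∅} (λ u _ u∈ → ⊥-elim (∉⊥ u∈))
    = let v , v∈C , _ = meets T maxT in v , v∈C

  image-independent : ∀ {k} (h : Fin k → Vtx G) → (∀ i j → ¬ Adj G (h i) (h j)) → IsIndependent G (image h)
  image-independent h h-indep u v u∈ v∈ with i , refl ← ∈-image⁻ h u∈ | j , refl ← ∈-image⁻ h v∈ =
    ¬Adj⇒adj≡false (h-indep i j)

  dominated⇒¬strong : ∀ {k C} (h : Fin k → Vtx G) → (∀ i j → ¬ Adj G (h i) (h j)) →
                      (∀ x → x ∈ C → ∃ λ i → Adj G x (h i)) → ¬ IsStrongClique G C
  dominated⇒¬strong h h-indep dominated (_ , meets)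
    with T , maxT , h⊆T ← maximal-extension (image-independent h h-indep)
    with x , x∈C , x∈T ← meets T maxT
    with i , a ← dominated x x∈C
    with () ← trans (sym a) (proj₁ maxT x (h i) x∈T (h⊆T (∈-image⁺ h i)))

  maximal-blocks : ∀ {S w} → IsMaximalIndependent G S → ¬ w ∈ S → Blocked S w
  maximal-blocks {S} {w} (indS , maxS) w∉S with blocked? S w
  ... | yes blocked = blocked
  ... | no  free    = ⊥-elim (w∉S (maxS _ (insert-independent indS free) (p⊆p∪q ⁅ w ⁆) (q⊆p∪q S ⁅ w ⁆ (x∈⁅x⁆ w))))

module Isomorphism {G H : Graph} (φ : G ≅ H) where
  open Inverse (_≅_.bij φ) public using (to; from; strictlyInverseˡ; strictlyInverseʳ)

  to-injective : ∀ {u v} → to u ≡ to v → u ≡ v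
  to-injective {u} {v} eq = trans (sym (strictlyInverseʳ u)) (trans (cong from eq) (strictlyInverseʳ v))

  adj-from : ∀ x y → adj G (from x) (from y) ≡ adj H x y
  adj-from x y = trans (_≅_.preserve φ (from x) (from y)) (cong₂ (adj H) (strictlyInverseˡ x) (strictlyInverseˡ y))

  preimage : Subset (n H) → Subset (n G)
  preimage S = setOf λ u → to u ∈? S

  ∈-preimage⁺ : ∀ {S u} → to u ∈ S → u ∈ preimage S
  ∈-preimage⁺ {S} = ∈-setOf⁺ λ u → to u ∈? S

  ∈-preimage⁻ : ∀ {S u} → u ∈ preimage S → to u ∈ S
  ∈-preimage⁻ {S} = ∈-setOf⁻ λ u → to u ∈? S

  preimage-independent : ∀ {S} → IsIndependent H S → IsIndependent G (preimage S)
  preimage-independent indS u v u∈ v∈ =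
    trans (_≅_.preserve φ u v) (indS (to u) (to v) (∈-preimage⁻ u∈) (∈-preimage⁻ v∈))

  preimage-clique : ∀ {C} → IsClique H C → IsClique G (preimage C)
  preimage-clique cliqueC u v u∈ v∈ u≢v =
    trans (_≅_.preserve φ u v) (cliqueC (to u) (to v) (∈-preimage⁻ u∈) (∈-preimage⁻ v∈) (u≢v ∘ to-injective))

≅-sym : ∀ {G H} → G ≅ H → H ≅ G
≅-sym φ = record { bij = mk↔ₛ′ from to strictlyInverseʳ strictlyInverseˡ ; preserve = λ x y → sym (adj-from x y) }
  where open Isomorphism φ

preimage-maximal : ∀ {G H S} (φ : G ≅ H) → IsMaximalIndependent H S → IsMaximalIndependent G (Isomorphism.preimage φ S)
preimage-maximal {G} {S = S} φ (indS , maxS) = preimage-independent indS , maximal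
  where
  open Isomorphism φ
  module ψ = Isomorphism (≅-sym φ)
  maximal : ∀ T → IsIndependent G T → preimage S ⊆ T → T ⊆ preimage S
  maximal T indT S⊆T {u} u∈T = ∈-preimage⁺ (maxS (ψ.preimage T) (ψ.preimage-independent indT) S⊆ψT to-u∈)
    where
    S⊆ψT : S ⊆ ψ.preimage T
    S⊆ψT {x} x∈S = ψ.∈-preimage⁺ (S⊆T (∈-preimage⁺ (subst (_∈ S) (sym (strictlyInverseˡ x)) x∈S)))
    to-u∈ : to u ∈ ψ.preimage T
    to-u∈ = ψ.∈-preimage⁺ (subst (_∈ T) (sym (strictlyInverseʳ u)) u∈T)

preimage-strong : ∀ {G H C} (φ : G ≅ H) → IsStrongClique H C → IsStrongClique G (Isomorphism.preimage φ C)
preimage-strong {G} {C = C} φ (cliqueC , meets) = preimage-clique cliqueC , meets′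
  where
  open Isomorphism φ
  meets′ : ∀ S → IsMaximalIndependent G S → ∃ λ v → v ∈ preimage C × v ∈ S
  meets′ S maxS with x , x∈C , x∈ψS ← meets _ (preimage-maximal (≅-sym φ) maxS) =
    from x , ∈-preimage⁺ (subst (_∈ C) (sym (strictlyInverseˡ x)) x∈C) , Isomorphism.∈-preimage⁻ (≅-sym φ) x∈ψS

HasStrongClique-transport : ∀ {G H} → G ≅ H → HasStrongClique H → HasStrongClique G
HasStrongClique-transport φ (C , strongC) = Isomorphism.preimage φ C , preimage-strong φ strongC

module ClosedCopy {Γ H : Graph} (g : Vtx H → Vtx Γ)
  (g-injective : ∀ {a b} → g a ≡ g b → a ≡ b)
  (g-adj : ∀ a b → adj Γ (g a) (g b) ≡ adj H a b)
  (g-closed : ∀ a u → Adj Γ (g a) u → ∃ λ b → g b ≡ u) where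

  reachable-in-image : ∀ {u v} → Reachable Γ u v → ∃ (λ a → g a ≡ u) → ∃ λ b → g b ≡ v
  reachable-in-image here           im        = im
  reachable-in-image (step u~w w⇝v) (a , refl) = reachable-in-image w⇝v (g-closed a _ u~w)

  connected⇒≅ : Vtx H → Connected Γ → Γ ≅ H
  connected⇒≅ a₀ conn = record { bij = mk↔ₛ′ index g index-g g-index ; preserve = preserve }
    where
    located : ∀ u → ∃ λ a → g a ≡ u
    located u = reachable-in-image (conn (g a₀) u) (a₀ , refl)
    index : Vtx Γ → Vtx H
    index u = proj₁ (located u)
    g-index : ∀ u → g (index u) ≡ u
    g-index u = proj₂ (located u)
    index-g : ∀ a → index (g a) ≡ a
    index-g a = g-injective (g-index (g a))
    preserve : ∀ u v → adj Γ u v ≡ adj H (index u) (index v)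
    preserve u v = trans (sym (cong₂ (adj Γ) (g-index u) (g-index v))) (g-adj (index u) (index v))

-- Four pairs of items: a combinatorial dichotomy

-- Items (i , s) come in four pairs indexed by i; a transversal σ chooses one item from each pair.
ItemRel : Set₁
ItemRel = Fin 4 → Fin 2 → Fin 4 → Fin 2 → Set

module Transversals (R : ItemRel) where

  Separated : Set
  Separated = ∀ i → ¬ R i zero i (suc zero)

  Collision : (Fin 4 → Fin 2) → Set
  Collision σ = ∃₂ λ i j → i < j × R i (σ i) j (σ j)

  Meets : Fin 4 → Fin 2 → Fin 4 → Set
  Meets i s j = ∃ λ t → R i s j t

  Universal : Set
  Universal = ∃₂ λ i s → ∀ j → Meets i s j

  Crowded : Set
  Crowded = ∃ λ i → ∀ s → ∃ λ d → ∀ j → j ≢ d → Meets i s j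

  Dichotomy : Set
  Dichotomy = Separated → (∀ σ → Collision σ) → Universal ⊎ Crowded

module _ {R R′ : ItemRel} (R⇒R′ : ∀ {i s j t} → R i s j t → R′ i s j t) (R′⇒R : ∀ {i s j t} → R′ i s j t → R i s j t) where
  private
    module T = Transversals R
    module T′ = Transversals R′

  dichotomy-transfer : T′.Dichotomy → T.Dichotomy
  dichotomy-transfer dichotomy′ separated collide with dichotomy′ (λ i → separated i ∘ R′⇒R) collision′
    where
    collision′ : ∀ σ → T′.Collision σ
    collision′ σ with i , j , i<j , r ← collide σ = i , j , i<j , R⇒R′ r
  ... | inj₁ (i , s , meets) = inj₁ (i , s , λ j → let t , r = meets j in t , R′⇒R r)
  ... | inj₂ (i , crowded)   = inj₂ (i , λ s → let d , meets = crowded s in d , λ j j≢d → let t , r = meets j j≢d in t , R′⇒R r)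

Labelling : Set
Labelling = Fin 4 → Fin 2 → ℕ

SameLabel : Labelling → ItemRel
SameLabel ℓ i s j t = ℓ i s ≡ ℓ j t

-- The dichotomy for labellings is checked by evaluation, over all labellings in which the k-th item
-- (in the order (0,0), (0,1), (1,0), …) has label at most k and the first pair is labelled 0, 1.
module Enumeration where

  choice : Fin 2 → Fin 2 → Fin 2 → Fin 2 → Fin 4 → Fin 2
  choice a b c d zero                   = a
  choice a b c d (suc zero)             = b
  choice a b c d (suc (suc zero))       = c
  choice a b c d (suc (suc (suc zero))) = d

  module _ (ℓ : Labelling) where
    open Transversals (SameLabel ℓ)

    Decided : Set
    Decided = (∃ λ i → ℓ i zero ≡ ℓ i (suc zero))
            ⊎ (∃₂ λ a b → ∃₂ λ c d → ¬ Collision (choice a b c d))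
            ⊎ Universal ⊎ Crowded

    decided⇒dichotomy : Decided → Dichotomy
    decided⇒dichotomy (inj₁ (i , same)) separated _ = ⊥-elim (separated i same)
    decided⇒dichotomy (inj₂ (inj₁ (a , b , c , d , free))) _ collide = ⊥-elim (free (collide (choice a b c d)))
    decided⇒dichotomy (inj₂ (inj₂ conclusion)) _ _ = conclusion

    collision? : ∀ σ → Dec (Collision σ)
    collision? σ = any? λ i → any? λ j → (i <? j) ×-dec (ℓ i (σ i) ℕ.≟ ℓ j (σ j))

    meets? : ∀ i s j → Dec (Meets i s j)
    meets? i s j = any? λ t → ℓ i s ℕ.≟ ℓ j t

    decided? : Dec Decided
    decided? = (any? λ i → ℓ i zero ℕ.≟ ℓ i (suc zero))
      ⊎-dec (any? λ a → any? λ b → any? λ c → any? λ d → ¬? (collision? (choice a b c d)))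
      ⊎-dec (any? λ i → any? λ s → all? λ j → meets? i s j)
      ⊎-dec (any? λ i → all? λ s → any? λ d → all? λ j → ¬? (j ≟ d) →-dec meets? i s j)

  restricted : ℕ → ℕ → ℕ → ℕ → ℕ → ℕ → Labelling
  restricted _  _  _  _  _  _  zero                   zero       = 0
  restricted _  _  _  _  _  _  zero                   (suc zero) = 1
  restricted c₂ _  _  _  _  _  (suc zero)             zero       = c₂
  restricted _  c₃ _  _  _  _  (suc zero)             (suc zero) = c₃
  restricted _  _  c₄ _  _  _  (suc (suc zero))       zero       = c₄
  restricted _  _  _  c₅ _  _  (suc (suc zero))       (suc zero) = c₅
  restricted _  _  _  _  c₆ _  (suc (suc (suc zero))) zero       = c₆
  restricted _  _  _  _  _  c₇ (suc (suc (suc zero))) (suc zero) = c₇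

  -- Opaque, so that Agda unfolds the exhaustive check only in all-checked.
  opaque
    all≤ : ℕ → (ℕ → Bool) → Bool
    all≤ ℕ.zero    f = f 0
    all≤ (ℕ.suc n) f = f (ℕ.suc n) ∧ all≤ n f

    all≤-sound : ∀ n f → all≤ n f ≡ true → ∀ {m} → m ≤ n → f m ≡ true
    all≤-sound ℕ.zero    f holds z≤n = holds
    all≤-sound (ℕ.suc n) f holds {m} m≤1+n with f (ℕ.suc n) in f[1+n] | m ℕ.≟ ℕ.suc n
    ... | true | yes refl   = f[1+n]
    ... | true | no m≢1+n   = all≤-sound n f holds (s≤s⁻¹ (≤∧≢⇒< m≤1+n m≢1+n))

  check₇ : ℕ → ℕ → ℕ → ℕ → ℕ → ℕ → Bool
  check₇ c₂ c₃ c₄ c₅ c₆ c₇ = isYes (decided? (restricted c₂ c₃ c₄ c₅ c₆ c₇))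
  check₆ : ℕ → ℕ → ℕ → ℕ → ℕ → Bool
  check₆ c₂ c₃ c₄ c₅ c₆ = all≤ 7 (check₇ c₂ c₃ c₄ c₅ c₆)
  check₅ : ℕ → ℕ → ℕ → ℕ → Bool
  check₅ c₂ c₃ c₄ c₅ = all≤ 6 (check₆ c₂ c₃ c₄ c₅)
  check₄ : ℕ → ℕ → ℕ → Bool
  check₄ c₂ c₃ c₄ = all≤ 5 (check₅ c₂ c₃ c₄)
  check₃ : ℕ → ℕ → Bool
  check₃ c₂ c₃ = all≤ 4 (check₄ c₂ c₃)
  check₂ : ℕ → Bool
  check₂ c₂ = all≤ 3 (check₃ c₂)

  opaque
    unfolding all≤
    all-checked : all≤ 2 check₂ ≡ true
    all-checked = refl

  restricted-decided : ∀ {c₂ c₃ c₄ c₅ c₆ c₇} → c₂ ≤ 2 → c₃ ≤ 3 → c₄ ≤ 4 → c₅ ≤ 5 → c₆ ≤ 6 → c₇ ≤ 7 →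
                       Decided (restricted c₂ c₃ c₄ c₅ c₆ c₇)
  restricted-decided {c₂} {c₃} {c₄} {c₅} {c₆} {c₇} ≤₂ ≤₃ ≤₄ ≤₅ ≤₆ ≤₇ = toWitness {a? = decided? (restricted c₂ c₃ c₄ c₅ c₆ c₇)} (Equivalence.from T-≡
    (all≤-sound 7 _ (all≤-sound 6 _ (all≤-sound 5 _ (all≤-sound 4 _ (all≤-sound 3 _
      (all≤-sound 2 check₂ all-checked ≤₂) ≤₃) ≤₄) ≤₅) ≤₆) ≤₇))

-- Labelling each item by the position of the first equivalent item turns any decidable equivalence into
-- equality of labels, with labels of the enumerated kind.
module CanonicalLabelling {X : Set} (_≈_ : X → X → Set) (≈-refl : ∀ {x} → x ≈ x)
  (≈-sym : ∀ {x y} → x ≈ y → y ≈ x) (≈-trans : ∀ {x y z} → x ≈ y → y ≈ z → x ≈ z)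
  (_≈?_ : ∀ x y → Dec (x ≈ y)) (e : Fin 4 → Fin 2 → X) where

  item : Fin 8 → X
  item k = uncurry e (remQuot {4} 2 k)

  item≈ : ∀ i s → item (combine i s) ≈ e i s
  item≈ i s = subst (_≈ e i s) (sym (cong (uncurry e) (remQuot-combine i s))) ≈-refl

  first : ∀ i s → ∃ λ k → item k ≈ e i s × ∀ {k′} → item k′ ≈ e i s → toℕ k ≤ toℕ k′
  first i s = least-witness {P = λ k → item k ≈ e i s} (λ k → item k ≈? e i s) {combine i s} (item≈ i s)

  label : Labelling
  label i s = toℕ (proj₁ (first i s))

  first≈ : ∀ i s → item (proj₁ (first i s)) ≈ e i s
  first≈ i s = proj₁ (proj₂ (first i s))

  first-minimal : ∀ i s {k} → item k ≈ e i s → label i s ≤ toℕ k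
  first-minimal i s = proj₂ (proj₂ (first i s))

  label-bound : ∀ i s → label i s ≤ toℕ (combine i s)
  label-bound i s = first-minimal i s {combine i s} (item≈ i s)

  same-label⇒≈ : ∀ {i s j t} → label i s ≡ label j t → e i s ≈ e j t
  same-label⇒≈ {i} {s} {j} {t} eq =
    ≈-trans (≈-sym (first≈ i s)) (subst (λ k → item k ≈ e j t) (sym (toℕ-injective eq)) (first≈ j t))

  ≈⇒same-label : ∀ {i s j t} → e i s ≈ e j t → label i s ≡ label j t
  ≈⇒same-label {i} {s} {j} {t} q =
    ≤-antisym (first-minimal i s (≈-trans (first≈ j t) (≈-sym q))) (first-minimal j t (≈-trans (first≈ i s) q))

  open Enumeration

  label-dichotomy : Transversals.Dichotomy (SameLabel label)
  label-dichotomy separated = dichotomy-transfer to-r from-r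
    (decided⇒dichotomy r (restricted-decided (label-bound _ _) (label-bound _ _) (label-bound _ _)
                                             (label-bound _ _) (label-bound _ _) (label-bound _ _)))
    separated
    where
    label₀₀ : label zero zero ≡ 0
    label₀₀ = n≤0⇒n≡0 (label-bound zero zero)
    label₀₁ : label zero (suc zero) ≡ 1
    label₀₁ with label zero (suc zero) | label-bound zero (suc zero) | separated zero
    ... | 0 | _       | separated₀ = ⊥-elim (separated₀ label₀₀)
    ... | 1 | _       | _          = refl
    ... | ℕ.suc (ℕ.suc _) | s≤s () | _
    r : Labelling
    r = restricted (label (suc zero) zero) (label (suc zero) (suc zero)) (label (suc (suc zero)) zero)
                   (label (suc (suc zero)) (suc zero)) (label (suc (suc (suc zero))) zero) (label (suc (suc (suc zero))) (suc zero))
    label≡r : ∀ i s → label i s ≡ r i s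
    label≡r zero                   zero       = label₀₀
    label≡r zero                   (suc zero) = label₀₁
    label≡r (suc zero)             zero       = refl
    label≡r (suc zero)             (suc zero) = refl
    label≡r (suc (suc zero))       zero       = refl
    label≡r (suc (suc zero))       (suc zero) = refl
    label≡r (suc (suc (suc zero))) zero       = refl
    label≡r (suc (suc (suc zero))) (suc zero) = refl
    to-r : ∀ {i s j t} → label i s ≡ label j t → r i s ≡ r j t
    to-r {i} {s} {j} {t} eq = trans (sym (label≡r i s)) (trans eq (label≡r j t))
    from-r : ∀ {i s j t} → r i s ≡ r j t → label i s ≡ label j t
    from-r {i} {s} {j} {t} eq = trans (label≡r i s) (trans eq (sym (label≡r j t)))

  dichotomy : Transversals.Dichotomy λ i s j t → e i s ≈ e j t
  dichotomy = dichotomy-transfer ≈⇒same-label same-label⇒≈ label-dichotomy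

-- Graphs all of whose local graphs are K₃ ⊕ K₂

fin2-pigeonhole : (a b c : Fin 2) → a ≡ b ⊎ a ≡ c ⊎ b ≡ c
fin2-pigeonhole zero       zero       _          = inj₁ refl
fin2-pigeonhole (suc zero) (suc zero) _          = inj₁ refl
fin2-pigeonhole zero       (suc zero) zero       = inj₂ (inj₁ refl)
fin2-pigeonhole zero       (suc zero) (suc zero) = inj₂ (inj₂ refl)
fin2-pigeonhole (suc zero) zero       zero       = inj₂ (inj₂ refl)
fin2-pigeonhole (suc zero) zero       (suc zero) = inj₂ (inj₁ refl)

module LocalStructure (Γ : Graph) (L : ∀ v → LocalGraphIso Γ v (K 3 ⊕ K 2)) where
  open GraphProperties Γ public

  V : Set
  V = Vtx Γ

  module _ (v : V) where
    private module Lv = Inverse (LocalGraphIso.bij (L v))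

    nbr : Fin 5 → V
    nbr a = proj₁ (Lv.to a)

    nbr-adj : ∀ a → Adj Γ v (nbr a)
    nbr-adj a = proj₂ (Lv.to a)

    adj-nbr : ∀ a b → adj Γ (nbr a) (nbr b) ≡ adj (K 3 ⊕ K 2) a b
    adj-nbr a b = sym (LocalGraphIso.preserve (L v) a b)

    nbr-injective : ∀ {a b} → nbr a ≡ nbr b → a ≡ b
    nbr-injective {a} {b} eq = trans (sym (Lv.strictlyInverseʳ a))
      (trans (cong Lv.from (neighbour-≡ (Lv.to a) (Lv.to b) eq)) (Lv.strictlyInverseʳ b))
      where
      neighbour-≡ : (x y : Neighbour Γ v) → proj₁ x ≡ proj₁ y → x ≡ y
      neighbour-≡ (u , p) (.u , q) refl = cong (u ,_) (Decidable⇒UIP.≡-irrelevant _≟ᵇ_ p q)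

    nbr-surjective : ∀ {u} → Adj Γ v u → ∃ λ a → nbr a ≡ u
    nbr-surjective {u} a = Lv.from (u , a) , cong proj₁ (Lv.strictlyInverseˡ (u , a))

  red : V → Fin 3 → V
  red v k = nbr v (k ↑ˡ 2)

  blue : V → Fin 2 → V
  blue v j = nbr v (3 ↑ʳ j)

  Red Blue : V → V → Set
  Red  v u = ∃ λ k → red v k ≡ u
  Blue v u = ∃ λ j → blue v j ≡ u

  red-injective : ∀ v {k k′} → red v k ≡ red v k′ → k ≡ k′
  red-injective v eq = ↑ˡ-injective 2 _ _ (nbr-injective v eq)

  blue-injective : ∀ v {j j′} → blue v j ≡ blue v j′ → j ≡ j′
  blue-injective v eq = ↑ʳ-injective 3 _ _ (nbr-injective v eq)

  Red⇒Adj : ∀ {v u} → Red v u → Adj Γ v u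
  Red⇒Adj {v} (k , refl) = nbr-adj v (k ↑ˡ 2)

  Blue⇒Adj : ∀ {v u} → Blue v u → Adj Γ v u
  Blue⇒Adj {v} (j , refl) = nbr-adj v (3 ↑ʳ j)

  Adj⇒Red⊎Blue : ∀ {v u} → Adj Γ v u → Red v u ⊎ Blue v u
  Adj⇒Red⊎Blue {v} a with b , refl ← nbr-surjective v a with splitAt 3 b in eq
  ... | inj₁ k = inj₁ (k , cong (nbr v) (trans (cong (join 3 2) (sym eq)) (join-splitAt 3 2 b)))
  ... | inj₂ j = inj₂ (j , cong (nbr v) (trans (cong (join 3 2) (sym eq)) (join-splitAt 3 2 b)))

  Red-Blue-disjoint : ∀ {v u} → Red v u → Blue v u → ⊥
  Red-Blue-disjoint {v} (k , refl) (j , eq) with () ←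
    trans (sym (splitAt-↑ˡ 3 k 2)) (trans (cong (splitAt 3) (nbr-injective v (sym eq))) (splitAt-↑ʳ 3 2 j))

  Red-Red-Adj : ∀ {v u w} → Red v u → Red v w → u ≢ w → Adj Γ u w
  Red-Red-Adj {v} (k , refl) (k′ , refl) u≢w =
    trans (adj-nbr v _ _) (trans (⊕-adj-ˡˡ (K 3) (K 2) k k′) (neqᵇ-≢ λ k≡k′ → u≢w (cong (red v) k≡k′)))

  Blue-Blue-Adj : ∀ {v u w} → Blue v u → Blue v w → u ≢ w → Adj Γ u w
  Blue-Blue-Adj {v} (j , refl) (j′ , refl) u≢w =
    trans (adj-nbr v _ _) (trans (⊕-adj-ʳʳ (K 3) (K 2) j j′) (neqᵇ-≢ λ j≡j′ → u≢w (cong (blue v) j≡j′)))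

  Red-Blue-¬Adj : ∀ {v u w} → Red v u → Blue v w → ¬ Adj Γ u w
  Red-Blue-¬Adj {v} (k , refl) (j , refl) a with () ← trans (sym a) (trans (adj-nbr v _ _) (⊕-adj-ˡʳ (K 3) (K 2) k j))

  blue-pigeonhole : ∀ {v a b c} → Blue v a → Blue v b → Blue v c → a ≡ b ⊎ a ≡ c ⊎ b ≡ c
  blue-pigeonhole (ja , refl) (jb , refl) (jc , refl) with fin2-pigeonhole ja jb jc
  ... | inj₁ refl        = inj₁ refl
  ... | inj₂ (inj₁ refl) = inj₂ (inj₁ refl)
  ... | inj₂ (inj₂ refl) = inj₂ (inj₂ refl)

  -- A red edge has two common neighbours, a blue edge only one: this makes redness symmetric and
  -- invariant under automorphisms.
  TwoCommon : V → V → Set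
  TwoCommon u w = ∃₂ λ z z′ → z ≢ z′ × (Adj Γ u z × Adj Γ w z) × (Adj Γ u z′ × Adj Γ w z′)

  TwoCommon-sym : ∀ {u w} → TwoCommon u w → TwoCommon w u
  TwoCommon-sym (z , z′ , z≢z′ , (uz , wz) , (uz′ , wz′)) = z , z′ , z≢z′ , (wz , uz) , (wz′ , uz′)

  Red⇒TwoCommon : ∀ {v u} → Red v u → TwoCommon v u
  Red⇒TwoCommon {v} (k , refl) =
    other zero , other (suc zero) , (λ eq → 0≢1+n (punchIn-injective k _ _ (red-injective v eq))) ,
    (nbr-adj v _ , Red-Red-Adj (k , refl) (_ , refl) (≢other zero)) ,
    (nbr-adj v _ , Red-Red-Adj (k , refl) (_ , refl) (≢other (suc zero)))
    where
    other : Fin 2 → V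
    other j = red v (punchIn k j)
    ≢other : ∀ j → red v k ≢ other j
    ≢other j eq = punchInᵢ≢i k j (red-injective v (sym eq))

  TwoCommon⇒Red : ∀ {v u} → Adj Γ v u → TwoCommon v u → Red v u
  TwoCommon⇒Red {v} {u} vu (z , z′ , z≢z′ , (vz , uz) , (vz′ , uz′)) with Adj⇒Red⊎Blue vu
  ... | inj₁ red = red
  ... | inj₂ blu with blue-pigeonhole blu (blue-common vz uz) (blue-common vz′ uz′)
    where
    blue-common : ∀ {x} → Adj Γ v x → Adj Γ u x → Blue v x
    blue-common vx ux with Adj⇒Red⊎Blue vx
    ... | inj₁ red = ⊥-elim (Red-Blue-¬Adj red blu (Adj-sym ux))
    ... | inj₂ b   = b
  ... | inj₁ u≡z         = ⊥-elim (Adj⇒≢ uz u≡z)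
  ... | inj₂ (inj₁ u≡z′) = ⊥-elim (Adj⇒≢ uz′ u≡z′)
  ... | inj₂ (inj₂ z≡z′) = ⊥-elim (z≢z′ z≡z′)

  Red-sym : ∀ {v u} → Red v u → Red u v
  Red-sym r = TwoCommon⇒Red (Adj-sym (Red⇒Adj r)) (TwoCommon-sym (Red⇒TwoCommon r))

  Blue-sym : ∀ {v u} → Blue v u → Blue u v
  Blue-sym b with Adj⇒Red⊎Blue (Adj-sym (Blue⇒Adj b))
  ... | inj₁ red = ⊥-elim (Red-Blue-disjoint (Red-sym red) b)
  ... | inj₂ b′  = b′

  Red-trans : ∀ {u v w} → Red u v → Red v w → u ≢ w → Red u w
  Red-trans uv vw u≢w with Adj⇒Red⊎Blue (Red-Red-Adj (Red-sym uv) vw u≢w)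
  ... | inj₁ red = red
  ... | inj₂ blu = ⊥-elim (Red-Blue-¬Adj uv blu (Red⇒Adj vw))

  Blue-trans : ∀ {u v w} → Blue u v → Blue v w → u ≢ w → Blue u w
  Blue-trans uv vw u≢w with Adj⇒Red⊎Blue (Blue-Blue-Adj (Blue-sym uv) vw u≢w)
  ... | inj₁ red = ⊥-elim (Red-Blue-¬Adj red uv (Adj-sym (Blue⇒Adj vw)))
  ... | inj₂ blu = blu

  Red? : ∀ v u → Dec (Red v u)
  Red? v u = any? λ k → red v k ≟ u

  Blue? : ∀ v u → Dec (Blue v u)
  Blue? v u = any? λ j → blue v j ≟ u

  open ReflexiveClosure Red Red-sym Red-trans Red? public
    renaming (Closure to SameRed; closure-sym to SameRed-sym; closure-trans to SameRed-trans; closure? to SameRed?)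
  open ReflexiveClosure Blue Blue-sym Blue-trans Blue? public
    renaming (Closure to SameBlue; closure-sym to SameBlue-sym; closure-trans to SameBlue-trans; closure? to SameBlue?)

  SameRed∧SameBlue⇒≡ : ∀ {u w} → SameRed u w → SameBlue u w → u ≡ w
  SameRed∧SameBlue⇒≡ (inj₁ u≡w) _           = u≡w
  SameRed∧SameBlue⇒≡ (inj₂ _)   (inj₁ u≡w)  = u≡w
  SameRed∧SameBlue⇒≡ (inj₂ r)   (inj₂ b)    = ⊥-elim (Red-Blue-disjoint r b)

  Adj⇒SameRed⊎SameBlue : ∀ {u w} → Adj Γ u w → SameRed u w ⊎ SameBlue u w
  Adj⇒SameRed⊎SameBlue a with Adj⇒Red⊎Blue a
  ... | inj₁ r = inj₁ (inj₂ r)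
  ... | inj₂ b = inj₂ (inj₂ b)

  SameRed⇒Adj : ∀ {u w} → SameRed u w → u ≢ w → Adj Γ u w
  SameRed⇒Adj (inj₁ u≡w) u≢w = ⊥-elim (u≢w u≡w)
  SameRed⇒Adj (inj₂ r)   _   = Red⇒Adj r

  SameBlue⇒Adj : ∀ {u w} → SameBlue u w → u ≢ w → Adj Γ u w
  SameBlue⇒Adj (inj₁ u≡w) u≢w = ⊥-elim (u≢w u≡w)
  SameBlue⇒Adj (inj₂ b)   _   = Blue⇒Adj b

  member : V → Fin 4 → V
  member v zero    = v
  member v (suc k) = red v k

  member-SameRed : ∀ v i → SameRed v (member v i)
  member-SameRed v zero    = inj₁ refl
  member-SameRed v (suc k) = inj₂ (k , refl)

  member-injective : ∀ v {i j} → member v i ≡ member v j → i ≡ j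
  member-injective v {zero}  {zero}   _  = refl
  member-injective v {zero}  {suc k}  eq = ⊥-elim (Adj⇒≢ (Red⇒Adj (k , refl)) eq)
  member-injective v {suc k} {zero}   eq = ⊥-elim (Adj⇒≢ (Red⇒Adj (k , refl)) (sym eq))
  member-injective v {suc k} {suc k′} eq = cong suc (red-injective v eq)

  member-onto : ∀ {v x} → SameRed v x → ∃ λ i → member v i ≡ x
  member-onto (inj₁ refl)    = zero , refl
  member-onto (inj₂ (k , eq)) = suc k , eq

  red-clique-filled : ∀ {v} (f : Fin 4 → V) → (∀ {i j} → f i ≡ f j → i ≡ j) → (∀ i → SameRed v (f i)) →
                      ∀ {x} → SameRed v x → ∃ λ i → f i ≡ x
  red-clique-filled {v} f f-injective f-in {x} x-in = i , (begin
      f i                  ≡⟨ proj₂ (member-onto (f-in i)) ⟨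
      member v (position i) ≡⟨ cong (member v) (proj₂ hit) ⟩
      member v (proj₁ (member-onto x-in)) ≡⟨ proj₂ (member-onto x-in) ⟩
      x ∎)
    where
    open ≡-Reasoning
    position : Fin 4 → Fin 4
    position i = proj₁ (member-onto (f-in i))
    position-injective : ∀ {i j} → position i ≡ position j → i ≡ j
    position-injective {i} {j} eq = f-injective
      (trans (sym (proj₂ (member-onto (f-in i)))) (trans (cong (member v) eq) (proj₂ (member-onto (f-in j)))))
    hit = injective⇒surjective position position-injective (proj₁ (member-onto x-in))
    i = proj₁ hit

module StrongCliques (Γ : Graph) (L : ∀ v → LocalGraphIso Γ v (K 3 ⊕ K 2)) where
  open LocalStructure Γ L
  open Independence Γ using (dominated⇒¬strong)

  clique-monochromatic : ∀ {C v} → IsClique Γ C → v ∈ C →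
                         (∀ {x} → x ∈ C → SameRed v x) ⊎ (∀ {x} → x ∈ C → SameBlue v x)
  clique-monochromatic {C} {v} clique v∈C with any? (λ x → (x ∈? C) ×-dec Blue? v x)
  ... | yes (b , b∈C , v-b) = inj₂ in-blue
    where
    in-blue : ∀ {x} → x ∈ C → SameBlue v x
    in-blue {x} x∈C with v ≟ x
    ... | yes v≡x = inj₁ v≡x
    ... | no  v≢x with Adj⇒Red⊎Blue (clique v x v∈C x∈C v≢x)
    ...   | inj₂ v-x = inj₂ v-x
    ...   | inj₁ v-x = ⊥-elim (Red-Blue-¬Adj v-x v-b (clique x b x∈C b∈C λ { refl → Red-Blue-disjoint v-x v-b }))
  ... | no no-blue = inj₁ in-red
    where
    in-red : ∀ {x} → x ∈ C → SameRed v x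
    in-red {x} x∈C with v ≟ x
    ... | yes v≡x = inj₁ v≡x
    ... | no  v≢x with Adj⇒Red⊎Blue (clique v x v∈C x∈C v≢x)
    ...   | inj₁ v-x = inj₂ v-x
    ...   | inj₂ v-x = ⊥-elim (no-blue (x , x∈C , v-x))

  blue-neighbour-unique : ∀ {x y z} → SameRed x y → Blue x z → Blue y z → x ≡ y
  blue-neighbour-unique x~y x-z y-z = SameRed∧SameBlue⇒≡ x~y (SameBlue-trans (inj₂ x-z) (inj₂ (Blue-sym y-z)))

  Blue⇒¬SameRed : ∀ {u w} → Blue u w → ¬ SameRed u w
  Blue⇒¬SameRed u-w u~w = Adj⇒≢ (Blue⇒Adj u-w) (SameRed∧SameBlue⇒≡ u~w (inj₂ u-w))

  ¬SameRed-across-blue : ∀ {v b y} → Blue v b → SameRed v y → ¬ SameRed b y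
  ¬SameRed-across-blue v-b v~y b~y = Blue⇒¬SameRed v-b (SameRed-trans v~y (SameRed-sym b~y))

  red-avoiding : ∀ {b z} → ¬ SameRed b z → ∃ λ d → ∀ k → k ≢ d → ¬ Adj Γ (red b k) z
  red-avoiding {b} {z} b≁z with any? (λ k → Adj? (red b k) z)
  ... | no none = zero , λ k _ a → none (k , a)
  ... | yes (d , d-z) = d , λ k k≢d k-z → k≢d (red-injective b
        (blue-neighbour-unique (SameRed-trans (SameRed-sym (inj₂ (k , refl))) (inj₂ (d , refl))) (towards k k-z) (towards d d-z)))
    where
    towards : ∀ k → Adj Γ (red b k) z → Blue (red b k) z
    towards k a with Adj⇒Red⊎Blue a
    ... | inj₁ r  = ⊥-elim (b≁z (SameRed-trans (inj₂ (k , refl)) (inj₂ r)))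
    ... | inj₂ bl = bl

  red-avoiding-two : ∀ {b z z′} → ¬ SameRed b z → ¬ SameRed b z′ → ∃ λ k → ¬ Adj Γ (red b k) z × ¬ Adj Γ (red b k) z′
  red-avoiding-two b≁z b≁z′ with d , avoid ← red-avoiding b≁z with d′ , avoid′ ← red-avoiding b≁z′
    with k , k∉ ← injective-avoids id id (lookup (d ∷ d′ ∷ [])) = k , avoid k (k∉ zero) , avoid′ k (k∉ (suc zero))

  blues-Blue : ∀ v {j j′} → j ≢ j′ → Blue (blue v j) (blue v j′)
  blues-Blue v j≢j′ = Blue-trans (Blue-sym (_ , refl)) (_ , refl) (j≢j′ ∘ blue-injective v)

  blue-clique-dominated : ∀ v → ∃ λ (y : Fin 3 → V) → (∀ i j → ¬ Adj Γ (y i) (y j)) ×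
                                                   (∀ {x} → SameBlue v x → ∃ λ i → Adj Γ x (y i))
  blue-clique-dominated v = y , independent , dominated
    where
    y₀ = red v zero
    P₁ = red-avoiding-two {blue v zero} {y₀} {y₀} (¬SameRed-across-blue (zero , refl) (inj₂ (zero , refl)))
                                                   (¬SameRed-across-blue (zero , refl) (inj₂ (zero , refl)))
    y₁ = red (blue v zero) (proj₁ P₁)
    P₂ = red-avoiding-two {blue v (suc zero)} {y₀} {y₁} (¬SameRed-across-blue (suc zero , refl) (inj₂ (zero , refl)))
                                                        (¬SameRed-across-blue (blues-Blue v λ ()) (inj₂ (proj₁ P₁ , refl)))
    y₂ = red (blue v (suc zero)) (proj₁ P₂)
    y : Fin 3 → V
    y = lookup (y₀ ∷ y₁ ∷ y₂ ∷ [])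
    independent : ∀ i j → ¬ Adj Γ (y i) (y j)
    independent zero             (suc zero)       = proj₁ (proj₂ P₁) ∘ Adj-sym
    independent zero             (suc (suc zero)) = proj₁ (proj₂ P₂) ∘ Adj-sym
    independent (suc zero)       zero             = proj₁ (proj₂ P₁)
    independent (suc zero)       (suc (suc zero)) = proj₂ (proj₂ P₂) ∘ Adj-sym
    independent (suc (suc zero)) zero             = proj₁ (proj₂ P₂)
    independent (suc (suc zero)) (suc zero)       = proj₂ (proj₂ P₂)
    independent zero             zero             a = Adj⇒≢ a refl
    independent (suc zero)       (suc zero)       a = Adj⇒≢ a refl
    independent (suc (suc zero)) (suc (suc zero)) a = Adj⇒≢ a refl
    dominated : ∀ {x} → SameBlue v x → ∃ λ i → Adj Γ x (y i)
    dominated (inj₁ refl)             = zero , Red⇒Adj (zero , refl)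
    dominated (inj₂ (zero , refl))     = suc zero , Red⇒Adj (proj₁ P₁ , refl)
    dominated (inj₂ (suc zero , refl)) = suc (suc zero) , Red⇒Adj (proj₁ P₂ , refl)

  strong⇒in-red-clique : ∀ {C v} → IsStrongClique Γ C → v ∈ C → ∀ {x} → x ∈ C → SameRed v x
  strong⇒in-red-clique {C} {v} strong v∈C with clique-monochromatic (proj₁ strong) v∈C
  ... | inj₁ in-red  = in-red
  ... | inj₂ in-blue = ⊥-elim (dominated⇒¬strong (proj₁ D) (proj₁ (proj₂ D)) (λ x x∈C → proj₂ (proj₂ D) (in-blue x∈C)) strong)
    where D = blue-clique-dominated v

  item : V → Fin 4 → Fin 2 → V
  item v i s = blue (member v i) s

  ItemsSameRed : V → ItemRel
  ItemsSameRed v i s j t = SameRed (item v i s) (item v j t)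

  items-separated : ∀ v → Transversals.Separated (ItemsSameRed v)
  items-separated v i same = Adj⇒≢ (Blue⇒Adj b) (SameRed∧SameBlue⇒≡ same (inj₂ b))
    where b = blues-Blue (member v i) {zero} {suc zero} λ ()

  items-of-distinct-members : ∀ v {i j s t} → i ≢ j → ¬ SameBlue (item v i s) (item v j t)
  items-of-distinct-members v {i} {j} i≢j same = i≢j (member-injective v (SameRed∧SameBlue⇒≡
    (SameRed-trans (SameRed-sym (member-SameRed v i)) (member-SameRed v j))
    (SameBlue-trans (inj₂ (_ , refl)) (SameBlue-trans same (inj₂ (Blue-sym (_ , refl)))))))

  -- Otherwise the chosen blue neighbours of the red clique of v form an independent set dominating C.
  strong⇒collisions : ∀ {C v} → IsStrongClique Γ C → v ∈ C → ∀ σ → Transversals.Collision (ItemsSameRed v) σ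
  strong⇒collisions {C} {v} strong v∈C σ with any? (λ i → any? λ j → (i <? j) ×-dec Adj? (item v i (σ i)) (item v j (σ j)))
  ... | yes (i , j , i<j , a) with Adj⇒SameRed⊎SameBlue a
  ...   | inj₁ same-red  = i , j , i<j , same-red
  ...   | inj₂ same-blue = ⊥-elim (items-of-distinct-members v (<⇒≢ i<j) same-blue)
  strong⇒collisions {C} {v} strong v∈C σ | no none =
    ⊥-elim (dominated⇒¬strong chosen independent dominated strong)
    where
    chosen : Fin 4 → V
    chosen i = item v i (σ i)
    independent : ∀ i j → ¬ Adj Γ (chosen i) (chosen j)
    independent i j a with <-cmp i j
    ... | tri< i<j _ _ = none (i , j , i<j , a)
    ... | tri≈ _ refl _ = Adj⇒≢ a refl
    ... | tri> _ _ j<i = none (j , i , j<i , Adj-sym a)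
    dominated : ∀ x → x ∈ C → ∃ λ i → Adj Γ x (chosen i)
    dominated x x∈C with i , refl ← member-onto (strong⇒in-red-clique strong v∈C x∈C) = i , Blue⇒Adj (σ i , refl)

module Linking (Γ : Graph) (L : ∀ v → LocalGraphIso Γ v (K 3 ⊕ K 2)) where
  open LocalStructure Γ L
  open StrongCliques Γ L

  Linked : V → V → Set
  Linked x w = ∃ λ z → Blue x z × SameRed z w

  FullyLinked MostlyLinked : V → V → Set
  FullyLinked  v w = ∀ {x} → SameRed v x → Linked x w
  MostlyLinked v w = ∃ λ d → ∀ {x} → SameRed v x → x ≢ d → Linked x w

  SomeBlueFullyLinked AllBluesFullyLinked AllBluesMostlyLinked : V → Set
  SomeBlueFullyLinked  v = ∃ λ w → Blue v w × FullyLinked v w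
  AllBluesFullyLinked  v = ∀ {w} → Blue v w → FullyLinked v w
  AllBluesMostlyLinked v = ∀ {w} → Blue v w → MostlyLinked v w

  -- The blue neighbours in R(w) of the four vertices of R(v) are distinct, hence fill R(w).
  FullyLinked-sym : ∀ {v w} → FullyLinked v w → FullyLinked w v
  FullyLinked-sym {v} {w} linked w~y =
    member v i , subst (λ z → Blue z (member v i)) (proj₂ filled) (Blue-sym (proj₁ (proj₂ (linked (member-SameRed v i))))) ,
    SameRed-sym (member-SameRed v i)
    where
    partner : Fin 4 → V
    partner i = proj₁ (linked (member-SameRed v i))
    partner-in : ∀ i → SameRed w (partner i)
    partner-in i = SameRed-sym (proj₂ (proj₂ (linked (member-SameRed v i))))
    partner-injective : ∀ {i j} → partner i ≡ partner j → i ≡ j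
    partner-injective {i} {j} eq = member-injective v (blue-neighbour-unique
      (SameRed-trans (SameRed-sym (member-SameRed v i)) (member-SameRed v j))
      (proj₁ (proj₂ (linked (member-SameRed v i))))
      (subst (Blue (member v j)) (sym eq) (proj₁ (proj₂ (linked (member-SameRed v j))))))
    filled = red-clique-filled partner partner-injective partner-in w~y
    i = proj₁ filled

  FullyLinked-trans : ∀ {u v w} → FullyLinked u v → FullyLinked v w → ¬ SameRed u w → FullyLinked u w
  FullyLinked-trans {u} {v} {w} u⇉v v⇉w u≁w {x} u~x with z , x-z , z~v ← u⇉v u~x with z′ , z-z′ , z′~w ← v⇉w (SameRed-sym z~v) =
    z′ , Blue-trans x-z z-z′ (λ { refl → u≁w (SameRed-trans u~x z′~w) }) , z′~w

  module PreservesRed (φ : Γ ≅ Γ) where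
    open Isomorphism φ

    Adj-to : ∀ {u v} → Adj Γ u v → Adj Γ (to u) (to v)
    Adj-to {u} {v} a = trans (sym (_≅_.preserve φ u v)) a

    TwoCommon-to : ∀ {u v} → TwoCommon u v → TwoCommon (to u) (to v)
    TwoCommon-to (z , z′ , z≢z′ , (uz , vz) , (uz′ , vz′)) =
      to z , to z′ , z≢z′ ∘ to-injective , (Adj-to uz , Adj-to vz) , (Adj-to uz′ , Adj-to vz′)

    Red-to : ∀ {u v} → Red u v → Red (to u) (to v)
    Red-to r = TwoCommon⇒Red (Adj-to (Red⇒Adj r)) (TwoCommon-to (Red⇒TwoCommon r))

  module Automorphism (φ : Γ ≅ Γ) where
    open Isomorphism φ
    open PreservesRed φ
    private module φ⁻¹ = PreservesRed (≅-sym φ)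

    Red-from : ∀ {u y} → Red (to u) y → Red u (from y)
    Red-from {u} r = subst (λ x → Red x _) (strictlyInverseʳ u) (φ⁻¹.Red-to r)

    Blue-to : ∀ {u v} → Blue u v → Blue (to u) (to v)
    Blue-to b with Adj⇒Red⊎Blue (Adj-to (Blue⇒Adj b))
    ... | inj₁ r  = ⊥-elim (Red-Blue-disjoint (subst (Red _) (strictlyInverseʳ _) (Red-from r)) b)
    ... | inj₂ b′ = b′

    Blue-from : ∀ {u y} → Blue (to u) y → Blue u (from y)
    Blue-from {u} {y} b with Adj⇒Red⊎Blue (subst (λ x → Adj Γ x (from y)) (strictlyInverseʳ u) (φ⁻¹.Adj-to (Blue⇒Adj b)))
    ... | inj₁ r  = ⊥-elim (Red-Blue-disjoint (subst (Red _) (strictlyInverseˡ y) (Red-to r)) b)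
    ... | inj₂ b′ = b′

    SameRed-to : ∀ {u v} → SameRed u v → SameRed (to u) (to v)
    SameRed-to (inj₁ refl) = inj₁ refl
    SameRed-to (inj₂ r)    = inj₂ (Red-to r)

    SameRed-from : ∀ {u y} → SameRed (to u) y → SameRed u (from y)
    SameRed-from {u} (inj₁ refl) = inj₁ (sym (strictlyInverseʳ u))
    SameRed-from     (inj₂ r)    = inj₂ (Red-from r)

    Linked-to : ∀ {x w} → Linked x w → Linked (to x) (to w)
    Linked-to (z , x-z , z~w) = to z , Blue-to x-z , SameRed-to z~w

    Linked-to-from : ∀ {y w} → Linked (from y) w → Linked y (to w)
    Linked-to-from {y} = subst (λ x → Linked x _) (strictlyInverseˡ y) ∘ Linked-to

    SomeBlueFullyLinked-to : ∀ {v} → SomeBlueFullyLinked v → SomeBlueFullyLinked (to v)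
    SomeBlueFullyLinked-to (w , v-w , v⇉w) = to w , Blue-to v-w , λ v~y → Linked-to-from (v⇉w (SameRed-from v~y))

    AllBluesMostlyLinked-to : ∀ {v} → AllBluesMostlyLinked v → AllBluesMostlyLinked (to v)
    AllBluesMostlyLinked-to {v} mostly {w} v-w with d , linked ← mostly (Blue-from v-w) =
      to d , λ {y} v~y y≢d → subst (Linked y) (strictlyInverseˡ w)
        (Linked-to-from (linked (SameRed-from v~y) λ { refl → y≢d (sym (strictlyInverseˡ y)) }))

  spread : VertexTransitive Γ → (P : V → Set) → (∀ φ {v} → P v → P (Isomorphism.to φ v)) → ∀ {u} → P u → ∀ v → P v
  spread vt P P-to {u} Pu v = subst P (proj₂ (vt u v)) (P-to (proj₁ (vt u v)) Pu)

  fully-linked-everywhere : (∀ v → SomeBlueFullyLinked v) → ∀ c → AllBluesFullyLinked c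
  fully-linked-everywhere linked c {w′} c-w′ with linked c
  ... | w , c-w , c⇉w with w′ ≟ w
  ...   | yes refl = c⇉w
  ...   | no  w′≢w with linked w′
  ...     | w″ , w′-w″ , w′⇉w″ with blue-pigeonhole w′-w″ (Blue-sym c-w′) (Blue-trans (Blue-sym c-w′) c-w w′≢w)
  ...       | inj₁ refl        = FullyLinked-sym w′⇉w″
  ...       | inj₂ (inj₁ refl) = FullyLinked-trans c⇉w (FullyLinked-sym w′⇉w″) (Blue⇒¬SameRed c-w′)
  ...       | inj₂ (inj₂ c≡w)  = ⊥-elim (Adj⇒≢ (Blue⇒Adj c-w) c≡w)

  linked-thrice : ∀ {p w w′ n} → Linked p w → Linked p w′ → Linked p n → ¬ SameRed w w′ → SameRed n w ⊎ SameRed n w′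
  linked-thrice (z₁ , p-z₁ , z₁~w) (z₂ , p-z₂ , z₂~w′) (z₃ , p-z₃ , z₃~n) w≁w′ with blue-pigeonhole p-z₁ p-z₂ p-z₃
  ... | inj₁ refl        = ⊥-elim (w≁w′ (SameRed-trans (SameRed-sym z₁~w) z₂~w′))
  ... | inj₂ (inj₁ refl) = inj₁ (SameRed-trans (SameRed-sym z₃~n) z₁~w)
  ... | inj₂ (inj₂ refl) = inj₂ (SameRed-trans (SameRed-sym z₃~n) z₂~w′)

  -- Each of the three witnesses misses at most one of the four vertices of R(c), so they share a vertex.
  blue-neighbours-split : (∀ v → AllBluesMostlyLinked v) → ∀ {c w w′ x n} → Blue c w → Blue c w′ → w ≢ w′ →
                          SameRed c x → Blue x n → SameRed n w ⊎ SameRed n w′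
  blue-neighbours-split mostly {c} {w} {w′} {x} {n} c-w c-w′ w≢w′ c~x x-n =
    linked-thrice (proj₂ M₁ c~p (p∉ zero)) (proj₂ M₂ c~p (p∉ (suc zero)))
                  (proj₂ M₃ (SameRed-trans (SameRed-sym c~x) c~p) (p∉ (suc (suc zero))))
                  (Blue⇒¬SameRed (Blue-trans (Blue-sym c-w) c-w′ w≢w′))
    where
    M₁ = mostly c c-w
    M₂ = mostly c c-w′
    M₃ = mostly x x-n
    avoiding = injective-avoids (member c) (member-injective c) (lookup (proj₁ M₁ ∷ proj₁ M₂ ∷ proj₁ M₃ ∷ []))
    c~p = member-SameRed c (proj₁ avoiding)
    p∉ = proj₂ avoiding

  mostly-linked-everywhere : (∀ v → AllBluesMostlyLinked v) → ∀ c → AllBluesFullyLinked c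
  mostly-linked-everywhere mostly c {w} (j , refl) {x} c~x = linked (split zero) (split (suc zero))
    where
    w′ = blue c (punchIn j zero)
    split : ∀ s → SameRed (blue x s) w ⊎ SameRed (blue x s) w′
    split s = blue-neighbours-split mostly (j , refl) (punchIn j zero , refl)
                (λ eq → punchInᵢ≢i j zero (sym (blue-injective c eq))) c~x (s , refl)
    linked : SameRed (blue x zero) w ⊎ SameRed (blue x zero) w′ → SameRed (blue x (suc zero)) w ⊎ SameRed (blue x (suc zero)) w′ →
             Linked x w
    linked (inj₁ x₀~w)  _            = blue x zero , (zero , refl) , x₀~w
    linked _            (inj₁ x₁~w)  = blue x (suc zero) , (suc zero , refl) , x₁~w
    linked (inj₂ x₀~w′) (inj₂ x₁~w′) = ⊥-elim (Blue⇒¬SameRed (blues-Blue x λ ()) (SameRed-trans x₀~w′ (SameRed-sym x₁~w′)))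

-- Copies of K₃ □ K₄

module Grid (Γ : Graph) (L : ∀ v → LocalGraphIso Γ v (K 3 ⊕ K 2)) where
  open LocalStructure Γ L
  open StrongCliques Γ L
  open Linking Γ L

  module _ (c : V) (linked : AllBluesFullyLinked c) where

    base : Fin 3 → V
    base zero    = c
    base (suc j) = blue c j

    -- cell x y: the vertex of the red clique of base x lying in the blue clique of member c y
    cell : Fin 3 → Fin 4 → V
    cell zero    y = member c y
    cell (suc j) y = proj₁ (linked (j , refl) (member-SameRed c y))

    cell-row : ∀ x y → SameRed (base x) (cell x y)
    cell-row zero    y = member-SameRed c y
    cell-row (suc j) y = SameRed-sym (proj₂ (proj₂ (linked (j , refl) (member-SameRed c y))))

    cell-column : ∀ x y → SameBlue (member c y) (cell x y)
    cell-column zero    y = inj₁ refl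
    cell-column (suc j) y = inj₂ (proj₁ (proj₂ (linked (j , refl) (member-SameRed c y))))

    base-SameBlue : ∀ x → SameBlue c (base x)
    base-SameBlue zero    = inj₁ refl
    base-SameBlue (suc j) = inj₂ (j , refl)

    base-injective : ∀ {x x′} → base x ≡ base x′ → x ≡ x′
    base-injective {zero}  {zero}   _  = refl
    base-injective {zero}  {suc j}  eq = ⊥-elim (Adj⇒≢ (Blue⇒Adj (j , refl)) eq)
    base-injective {suc j} {zero}   eq = ⊥-elim (Adj⇒≢ (Blue⇒Adj (j , refl)) (sym eq))
    base-injective {suc j} {suc j′} eq = cong suc (blue-injective c eq)

    same-row : ∀ {x y x′ y′} → SameRed (cell x y) (cell x′ y′) → x ≡ x′
    same-row {x} {y} {x′} {y′} same = base-injective (SameRed∧SameBlue⇒≡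
      (SameRed-trans (cell-row x y) (SameRed-trans same (SameRed-sym (cell-row x′ y′))))
      (SameBlue-trans (SameBlue-sym (base-SameBlue x)) (base-SameBlue x′)))

    same-column : ∀ {x y x′ y′} → SameBlue (cell x y) (cell x′ y′) → y ≡ y′
    same-column {x} {y} {x′} {y′} same = member-injective c (SameRed∧SameBlue⇒≡
      (SameRed-trans (SameRed-sym (member-SameRed c y)) (member-SameRed c y′))
      (SameBlue-trans (cell-column x y) (SameBlue-trans same (SameBlue-sym (cell-column x′ y′)))))

    cell-injective : ∀ {a b} → uncurry cell a ≡ uncurry cell b → a ≡ b
    cell-injective {x , y} {x′ , y′} eq
      with same-row {x} {y} {x′} {y′} (inj₁ eq) | same-column {x} {y} {x′} {y′} (inj₁ eq)
    ... | refl | refl = refl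

    cell-adj : ∀ a b → adj Γ (uncurry cell a) (uncurry cell b) ≡ pairAdj a b
    cell-adj (x , y) (x′ , y′) with x ≟ x′ | y ≟ y′
    ... | yes refl | yes refl = adj-irrefl Γ (cell x y)
    ... | yes refl | no y≢y′  = SameRed⇒Adj (SameRed-trans (SameRed-sym (cell-row x y)) (cell-row x y′))
                                            (y≢y′ ∘ cong proj₂ ∘ cell-injective {x , y} {x , y′})
    ... | no x≢x′  | yes refl = SameBlue⇒Adj (SameBlue-trans (SameBlue-sym (cell-column x y)) (cell-column x′ y))
                                             (x≢x′ ∘ cong proj₁ ∘ cell-injective {x , y} {x′ , y})
    ... | no x≢x′  | no y≢y′  = ¬Adj⇒adj≡false apart
      where
      apart : ¬ Adj Γ (cell x y) (cell x′ y′)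
      apart a with Adj⇒SameRed⊎SameBlue a
      ... | inj₁ same = x≢x′ (same-row {x} {y} {x′} {y′} same)
      ... | inj₂ same = y≢y′ (same-column {x} {y} {x′} {y′} same)

    cell-closed : ∀ a u → Adj Γ (uncurry cell a) u → ∃ λ b → uncurry cell b ≡ u
    cell-closed (x , y) u a with Adj⇒Red⊎Blue a
    ... | inj₁ r = let y′ , eq = red-clique-filled (cell x) row-injective (cell-row x) (SameRed-trans (cell-row x y) (inj₂ r))
                   in (x , y′) , eq
      where
      row-injective : ∀ {y y′} → cell x y ≡ cell x y′ → y ≡ y′
      row-injective {y} {y′} eq = same-column {x} {y} {x} {y′} (inj₁ eq)
    ... | inj₂ b with blue-pigeonhole b (column-blue zero) (column-blue (suc zero))
      where
      column-blue : ∀ j → Blue (cell x y) (cell (punchIn x j) y)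
      column-blue j with SameBlue-trans (SameBlue-sym (cell-column x y)) (cell-column (punchIn x j) y)
      ... | inj₂ blu  = blu
      ... | inj₁ same = ⊥-elim (punchInᵢ≢i x j (sym (cong proj₁ (cell-injective {x , y} {punchIn x j , y} same))))
    ... | inj₁ u≡      = (punchIn x zero , y) , sym u≡
    ... | inj₂ (inj₁ u≡) = (punchIn x (suc zero) , y) , sym u≡
    ... | inj₂ (inj₂ same) = ⊥-elim (0≢1+n (punchIn-injective x _ _ (same-row {punchIn x zero} {y} {punchIn x (suc zero)} {y} (inj₁ same))))

    grid-≅ : Connected Γ → Γ ≅ K□K 3 4
    grid-≅ = ClosedCopy.connected⇒≅ g g-injective g-adj g-closed zero
      where
      g : Fin (3 * 4) → V
      g k = uncurry cell (remQuot {3} 4 k)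
      g-injective : ∀ {k k′} → g k ≡ g k′ → k ≡ k′
      g-injective {k} {k′} eq = trans (sym (combine-remQuot {3} 4 k))
        (trans (cong (uncurry combine) (cell-injective {remQuot {3} 4 k} {remQuot {3} 4 k′} eq)) (combine-remQuot {3} 4 k′))
      g-adj : ∀ k k′ → adj Γ (g k) (g k′) ≡ adj (K□K 3 4) k k′
      g-adj k k′ = cell-adj (remQuot {3} 4 k) (remQuot {3} 4 k′)
      g-closed : ∀ k u → Adj Γ (g k) u → ∃ λ k′ → g k′ ≡ u
      g-closed k u a with (x , y) , eq ← cell-closed (remQuot {3} 4 k) u a =
        combine x y , trans (cong (uncurry cell) (remQuot-combine x y)) eq

neqᵇ-false⇒≡ : ∀ {k} {x y : Fin k} → neqᵇ x y ≡ false → x ≡ y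
neqᵇ-false⇒≡ {x = x} {y} e with x ≟ y
... | yes x≡y = x≡y

pairAdj-sameRow : ∀ {p q} {a b : Fin p × Fin q} → proj₁ a ≡ proj₁ b → proj₂ a ≢ proj₂ b → pairAdj a b ≡ true
pairAdj-sameRow {a = x , y} {.x , y′} refl y≢y′ rewrite neqᵇ-irrefl x | neqᵇ-≢ y≢y′ = refl

pairAdj-sameColumn : ∀ {p q} {a b : Fin p × Fin q} → pairAdj a b ≡ true → proj₁ a ≢ proj₁ b → proj₂ a ≡ proj₂ b
pairAdj-sameColumn {a = x , y} {x′ , y′} a x≢x′ rewrite neqᵇ-≢ x≢x′ with neqᵇ y y′ in eq
... | false = neqᵇ-false⇒≡ eq

module FirstRow (p q : ℕ) (p<q : p <ℕ q) where
  Γ : Graph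
  Γ = K□K (ℕ.suc p) q
  open Independence Γ using (maximal-blocks)

  coords : Vtx Γ → Fin (ℕ.suc p) × Fin q
  coords = remQuot {ℕ.suc p} q

  cell : Fin (ℕ.suc p) → Fin q → Vtx Γ
  cell = combine

  cell-coords : ∀ u → uncurry cell (coords u) ≡ u
  cell-coords = combine-remQuot {ℕ.suc p} q

  firstRow : Subset (n Γ)
  firstRow = setOf λ u → proj₁ (coords u) ≟ zero

  coords-injective : ∀ {u v} → coords u ≡ coords v → u ≡ v
  coords-injective {u} {v} eq = trans (sym (cell-coords u)) (trans (cong (uncurry cell) eq) (cell-coords v))

  firstRow-clique : IsClique Γ firstRow
  firstRow-clique u v u∈ v∈ u≢v = pairAdj-sameRow rows≡ λ cols≡ → u≢v (coords-injective (×-≡,≡→≡ (rows≡ , cols≡)))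
    where
    rows≡ : proj₁ (coords u) ≡ proj₁ (coords v)
    rows≡ = trans (∈-setOf⁻ (λ u → proj₁ (coords u) ≟ zero) u∈) (sym (∈-setOf⁻ (λ u → proj₁ (coords u) ≟ zero) v∈))

  coords-cell : ∀ x y → coords (cell x y) ≡ (x , y)
  coords-cell = remQuot-combine

  cell∈firstRow : ∀ y → cell zero y ∈ firstRow
  cell∈firstRow y = ∈-setOf⁺ (λ u → proj₁ (coords u) ≟ zero) (cong proj₁ (coords-cell zero y))

  lower-blocker : ∀ {S} → IsMaximalIndependent Γ S → (∀ y → ¬ cell zero y ∈ S) → ∀ y → ∃ λ r → cell (suc r) y ∈ S
  lower-blocker {S} maxS miss y with maximal-blocks maxS (miss y)
  ... | u , u∈S , a with coords u in eq
  ... | zero , y′ = ⊥-elim (miss y′ (subst (_∈ S) u≡ u∈S))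
    where u≡ = trans (sym (cell-coords u)) (cong (uncurry cell) eq)
  ... | suc r , y′ = r , subst (_∈ S) u≡ u∈S
    where
    y′≡y : y′ ≡ y
    y′≡y = pairAdj-sameColumn {a = suc r , y′} {b = zero , y} (subst₂ (λ a b → pairAdj a b ≡ true) eq (coords-cell zero y) a) λ ()
    u≡ = trans (sym (cell-coords u)) (cong (uncurry cell) (trans eq (cong (suc r ,_) y′≡y)))

  cells-adjacent : ∀ r {y y′} → y ≢ y′ → Adj Γ (cell r y) (cell r y′)
  cells-adjacent r {y} {y′} y≢y′ =
    subst₂ (λ a b → pairAdj a b ≡ true) (sym (coords-cell r y)) (sym (coords-cell r y′)) (pairAdj-sameRow {a = r , y} {b = r , y′} refl y≢y′)

  firstRow-strong : IsStrongClique Γ firstRow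
  firstRow-strong = firstRow-clique , meets
    where
    meets : ∀ S → IsMaximalIndependent Γ S → ∃ λ v → v ∈ firstRow × v ∈ S
    meets S maxS with any? (λ y → cell zero y ∈? S)
    ... | yes (y , y∈S) = cell zero y , cell∈firstRow y , y∈S
    ... | no miss with lower-blocker maxS (λ y y∈ → miss (y , y∈))
    ... | blocker with y₁ , y₂ , y₁<y₂ , same ← pigeonhole p<q (proj₁ ∘ blocker)
      with r , r∈ ← blocker y₁ | r′ , r′∈ ← blocker y₂
      with refl ← same
      with () ← trans (sym (cells-adjacent (suc r) (<⇒≢ y₁<y₂))) (proj₁ maxS _ _ r∈ r′∈)

module FromStrongClique (Γ : Graph) (L : ∀ v → LocalGraphIso Γ v (K 3 ⊕ K 2)) where
  open LocalStructure Γ L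
  open StrongCliques Γ L
  open Linking Γ L
  open Transversals

  item-linked : ∀ v i {s} j {t} → ItemsSameRed v i s j t → Linked (member v j) (item v i s)
  item-linked v i j {t} same = item v j t , (t , refl) , SameRed-sym same

  via-member : ∀ {v} i (P : V → Set) → (∀ j → P (member v j)) → ∀ {x} → SameRed (member v i) x → P x
  via-member {v} i P P-member i~x = subst P (proj₂ found) (P-member (proj₁ found))
    where found = member-onto (SameRed-trans (member-SameRed v i) i~x)

  universal⇒SomeBlueFullyLinked : ∀ {v} → Universal (ItemsSameRed v) → ∃ SomeBlueFullyLinked
  universal⇒SomeBlueFullyLinked {v} (i , s , meets) =
    member v i , item v i s , (s , refl) , via-member i (λ x → Linked x (item v i s)) (λ j → item-linked v i j (proj₂ (meets j)))

  crowded⇒AllBluesMostlyLinked : ∀ {v} → Crowded (ItemsSameRed v) → ∃ AllBluesMostlyLinked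
  crowded⇒AllBluesMostlyLinked {v} (i , crowded) = member v i , mostly
    where
    mostly : AllBluesMostlyLinked (member v i)
    mostly (s , refl) = member v d , via-member i (λ x → x ≢ member v d → Linked x (item v i s))
                          (λ j j≢d → item-linked v i j (proj₂ (proj₂ (crowded s) j λ { refl → j≢d refl })))
      where d = proj₁ (crowded s)

  strong⇒AllBluesFullyLinked : VertexTransitive Γ → ∀ {C} → IsStrongClique Γ C → ∀ c → AllBluesFullyLinked c
  strong⇒AllBluesFullyLinked vt strong = conclude
    (CanonicalLabelling.dichotomy SameRed (inj₁ refl) SameRed-sym SameRed-trans SameRed? (item v)
       (items-separated v) (strong⇒collisions strong (proj₂ witness)))
    where
    witness = Independence.strong-nonempty Γ strong
    v = proj₁ witness
    conclude : Universal (ItemsSameRed v) ⊎ Crowded (ItemsSameRed v) → ∀ c → AllBluesFullyLinked c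
    conclude (inj₁ universal) = fully-linked-everywhere
      (spread vt SomeBlueFullyLinked Automorphism.SomeBlueFullyLinked-to (proj₂ (universal⇒SomeBlueFullyLinked universal)))
    conclude (inj₂ crowded)   = mostly-linked-everywhere
      (spread vt AllBluesMostlyLinked Automorphism.AllBluesMostlyLinked-to (proj₂ (crowded⇒AllBluesMostlyLinked crowded)))

lemma5p12 : (Γ : Graph) → Connected Γ → VertexTransitive Γ →
            (∀ v → LocalGraphIso Γ v (K 3 ⊕ K 2)) →
            (HasStrongClique Γ ⇔ (Γ ≅ K□K 3 4))
lemma5p12 Γ connected vt L = mk⇔ forward backward
  where
  forward : HasStrongClique Γ → Γ ≅ K□K 3 4
  forward (C , strong) = Grid.grid-≅ Γ L c (FromStrongClique.strong⇒AllBluesFullyLinked Γ L vt strong c) connected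
    where c = proj₁ (Independence.strong-nonempty Γ strong)
  backward : Γ ≅ K□K 3 4 → HasStrongClique Γ
  backward φ = HasStrongClique-transport φ (firstRow , firstRow-strong)
    where open FirstRow 2 4 (s≤s (s≤s (s≤s z≤n)))
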